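{- Let $M$ be a finite matroid on ground set $E$ with rank function $r$, and let $E_1,\dots,E_k\subseteq E$ with $k=|E|-r(M)$, where each $E_i$ is a union of some circuits of $M$. Then $\mathcal{B}'[E_1,\dots,E_k]=\{E-D: D\in\mathcal{Q}(E_1,\dots,E_k)\}$.
   Context: $N_k=\{1,\dots,k\}$. $\bigvee_{j\in I}E_j$ denotes the set of elements belonging to exactly one of the $E_j$, $j\in I$. $\mathcal{Q}(E_1,\dots,E_k)$ is the set of $k$-element sets $D$ with $D\cap\bigvee_{j\in I}E_j\neq\emptyset$ for every non-empty $I\subseteq N_k$. $\mathcal{B}'[E_1,\dots,E_k]$ is the set of bases $B$ of $M$ such that $B\not\supseteq\bigvee_{i\in I}E_i$ for every non-empty $I\subseteq N_k$. -}

module Defs where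

open import Data.Nat using (ℕ; _<_; _≤_)
open import Data.Fin using (Fin)
open import Data.Fin.Subset using (Subset; _∈_; _∉_; _⊆_; _⊂_; ∣_∣; ⁅_⁆; _∪_; ⊥; Nonempty)
open import Data.Product using (Σ; ∃; _×_)
open import Relation.Nullary using (¬_; Dec)
open import Relation.Binary.PropositionalEquality using (_≡_)

-- A finite matroid on the ground set E = Fin n, given by its independent sets
-- (standard independence axioms I1–I3).  Independence is decidable (automatic
-- classically for a finite matroid).
record Matroid (n : ℕ) : Set₁ where
  field
    Indep      : Subset n → Set
    indep?     : (X : Subset n) → Dec (Indep X)
    indep-∅    : Indep ⊥
    indep-⊆    : ∀ {X Y} → Indep Y → X ⊆ Y → Indep X
    indep-aug  : ∀ {X Y} → Indep X → Indep Y → ∣ X ∣ < ∣ Y ∣ →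
                 ∃ λ e → e ∈ Y × e ∉ X × Indep (X ∪ ⁅ e ⁆)

open Matroid public

module _ {n : ℕ} (M : Matroid n) where

  IsBasis : Subset n → Set
  IsBasis B = Indep M B × (∀ X → Indep M X → B ⊆ X → X ≡ B)

  IsCircuit : Subset n → Set
  IsCircuit C = ¬ Indep M C × (∀ X → X ⊂ C → Indep M X)

  IsRankOf : ℕ → Set
  IsRankOf ρ = (∃ λ X → Indep M X × ∣ X ∣ ≡ ρ) × (∀ X → Indep M X → ∣ X ∣ ≤ ρ)

  IsUnionOfCircuits : Subset n → Set
  IsUnionOfCircuits X = ∀ x → x ∈ X → ∃ λ C → IsCircuit C × C ⊆ X × x ∈ C

module _ {n k : ℕ} (E : Fin k → Subset n) where

  InExactlyOne : Subset k → Fin n → Set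
  InExactlyOne I x = ∃ λ j → j ∈ I × x ∈ E j × (∀ j′ → j′ ∈ I → x ∈ E j′ → j′ ≡ j)

  InQ : Subset n → Set
  InQ D = ∣ D ∣ ≡ k ×
          (∀ (I : Subset k) → Nonempty I → ∃ λ x → x ∈ D × InExactlyOne I x)

module _ {n k : ℕ} (M : Matroid n) (E : Fin k → Subset n) where

  InB′ : Subset n → Set
  InB′ B = IsBasis M B ×
           (∀ (I : Subset k) → Nonempty I → ¬ (∀ x → InExactlyOne E I x → x ∈ B))

-- A basis B of M has |B| = r(M), so D = E − B has k elements, and B ⊉ ⋁_{j∈I} E_j says
-- exactly that D meets ⋁_{j∈I} E_j; the real content is that E − D is independent for
-- every D ∈ 𝒬(E₁,…,E_k).  For that, build R ⊆ D by induction on I ⊆ N_k: pick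
-- x ∈ D ∩ ⋁_{j∈I} E_j, lying in E_j only, and recurse on I − j.  Since E_j is a union of
-- circuits, x lies on a circuit C ⊆ E_j, so x is spanned by C − x; this keeps R in the
-- closure of every T containing (⋃_{j∈I} E_j) − R, while |R| ≥ |I|.  For I = N_k this
-- forces R = D and E − D spans D, hence spans E; having r(M) elements, E − D is a basis.
module Submission where

open import Defs
open import Data.Nat using (ℕ; _∸_; suc; _≤_; s≤s; _≤?_)
open import Data.Nat.Properties
  using (≤-trans; ≤-reflexive; ≤-antisym; ≰⇒>; <⇒≱; n≤1+n; m∸[m∸n]≡n; module ≤-Reasoning)
open import Data.Fin using (Fin; zero; suc; _≟_)
open import Data.Fin.Subset
  using (Subset; ∁; _∈_; _∉_; _⊆_; _⊂_; _⊃_; ∣_∣; ⁅_⁆; _∪_; _-_; ⊥; ⊤; Nonempty; inside; outside)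
open import Data.Fin.Subset.Properties
  using ( _∈?_; nonempty?; ∉⊥; x∈⁅x⁆; x∈⁅y⁆⇒x≡y; Empty-unique; ∣⊥∣≡0; ∣⊤∣≡n; ∣p∣≤n
        ; ∣∁p∣≡n∸∣p∣; p⊆q⇒∣p∣≤∣q∣; p⊂q⇒∣p∣<∣q∣; ⊆-refl; ⊆-trans; ⊆-antisym; ⊆-max
        ; p⊆p∪q; q⊆p∪q; x∈p∪q⁻; x∈p∪q⁺; ∪-assoc; ∪-identityʳ; ∪-inverseˡ; ∪-∩-booleanAlgebra
        ; p─q⊆p; drop-there; x∈p∧x≢y⇒x∈p-y; x∈p⇒p-x⊂p; x∉p⇒x∈∁p; x∈∁p⇒x∉p)
open import Data.Fin.Subset.Induction using (⊂-wellFounded; ⊃-wellFounded)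
open import Data.Fin.Properties using (any?; all?; ¬∀⟶∃¬)
open import Data.Vec using (_∷_; there; tail)
open import Data.Product using (∃; _×_; _,_)
open import Data.Sum using (inj₁; inj₂; [_,_])
open import Function using (_∘_)
open import Function.Bundles using (_⇔_; mk⇔)
open import Induction.WellFounded using (WfRec; module All)
open import Level using (0ℓ)
open import Relation.Nullary using (¬_; Dec; yes; no; contradiction)
open import Relation.Nullary.Decidable using (_×-dec_; _→-dec_)
open import Relation.Binary.PropositionalEquality using (_≡_; _≢_; refl; sym; trans; cong; subst; module ≡-Reasoning)
import Algebra.Lattice.Properties.BooleanAlgebra as BooleanAlgebraProperties

private
  variable
    n : ℕ
    p q r : Subset n
    x : Fin n

∪-least : p ⊆ r → q ⊆ r → p ∪ q ⊆ r
∪-least {p = p} {q = q} p⊆r q⊆r = [ p⊆r , q⊆r ] ∘ x∈p∪q⁻ p q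

x∉p-x : ∀ (p : Subset n) x → x ∉ p - x
x∉p-x (s ∷ p) zero    ()
x∉p-x (s ∷ p) (suc x) (there x∈p-x) = x∉p-x p x x∈p-x

p⊆p-x∪⁅x⁆ : ∀ (p : Subset n) x → p ⊆ (p - x) ∪ ⁅ x ⁆
p⊆p-x∪⁅x⁆ p x {y} y∈p with y ≟ x
... | yes refl = x∈p∪q⁺ (inj₂ (x∈⁅x⁆ x))
... | no  y≢x  = x∈p∪q⁺ (inj₁ (x∈p∧x≢y⇒x∈p-y y∈p y≢x))

-- The tail of `(s ∷ p) - zero` is not definitionally `p ─ ⊥`, so `p─⊥≡p` does not apply.
tail[s∷p-zero]⊇p : ∀ s (p : Subset n) → p ⊆ tail ((s ∷ p) - zero)
tail[s∷p-zero]⊇p s p y∈p = drop-there (x∈p∧x≢y⇒x∈p-y {p = s ∷ p} {y = zero} (there y∈p) λ ())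

∣p∣≤1+∣p-x∣ : ∀ (p : Subset n) x → ∣ p ∣ ≤ suc ∣ p - x ∣
∣p∣≤1+∣p-x∣ (inside  ∷ p) zero    = s≤s (p⊆q⇒∣p∣≤∣q∣ (tail[s∷p-zero]⊇p inside p))
∣p∣≤1+∣p-x∣ (outside ∷ p) zero    = ≤-trans (p⊆q⇒∣p∣≤∣q∣ (tail[s∷p-zero]⊇p outside p)) (n≤1+n _)
∣p∣≤1+∣p-x∣ (inside  ∷ p) (suc x) = s≤s (∣p∣≤1+∣p-x∣ p x)
∣p∣≤1+∣p-x∣ (outside ∷ p) (suc x) = ∣p∣≤1+∣p-x∣ p x

p⊂p∪⁅x⁆ : x ∉ p → p ⊂ p ∪ ⁅ x ⁆
p⊂p∪⁅x⁆ {x = x} x∉p = p⊆p∪q ⁅ x ⁆ , x , x∈p∪q⁺ (inj₂ (x∈⁅x⁆ x)) , x∉p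

p⊆q∧∣q∣≤∣p∣⇒p≡q : p ⊆ q → ∣ q ∣ ≤ ∣ p ∣ → p ≡ q
p⊆q∧∣q∣≤∣p∣⇒p≡q {p = p} {q = q} p⊆q ∣q∣≤∣p∣ = ⊆-antisym p⊆q q⊆p
  where
  q⊆p : q ⊆ p
  q⊆p {y} y∈q with y ∈? p
  ... | yes y∈p = y∈p
  ... | no  y∉p = contradiction ∣q∣≤∣p∣ (<⇒≱ (p⊂q⇒∣p∣<∣q∣ (p⊆q , y , y∈q , y∉p)))

∁-involutive : ∀ (p : Subset n) → ∁ (∁ p) ≡ p
∁-involutive = BooleanAlgebraProperties.¬-involutive (∪-∩-booleanAlgebra _)

module _ (M : Matroid n) where

  indep-augment : ∀ {A Z} → Indep M A → Indep M Z →
                  ∃ λ A′ → Indep M A′ × A ⊆ A′ × A′ ⊆ A ∪ Z × ∣ Z ∣ ≤ ∣ A′ ∣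
  indep-augment {A} {Z} iA iZ = All.wfRec ⊃-wellFounded 0ℓ Augmentable augment A iA
    where
    Augmentable : Subset n → Set
    Augmentable A = Indep M A → ∃ λ A′ → Indep M A′ × A ⊆ A′ × A′ ⊆ A ∪ Z × ∣ Z ∣ ≤ ∣ A′ ∣

    augment : ∀ A → WfRec _⊃_ Augmentable A → Augmentable A
    augment A rec iA with ∣ Z ∣ ≤? ∣ A ∣
    ... | yes ∣Z∣≤∣A∣ = A , iA , ⊆-refl , p⊆p∪q Z , ∣Z∣≤∣A∣
    ... | no  ∣Z∣≰∣A∣ with indep-aug M iA iZ (≰⇒> ∣Z∣≰∣A∣)
    ... | e , e∈Z , e∉A , iA+e with rec (p⊂p∪⁅x⁆ e∉A) iA+e
    ... | A′ , iA′ , A+e⊆A′ , A′⊆ , ∣Z∣≤∣A′∣ =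
      A′ , iA′ , ⊆-trans (p⊆p∪q ⁅ e ⁆) A+e⊆A′ , ⊆-trans A′⊆ A+e∪Z⊆A∪Z , ∣Z∣≤∣A′∣
      where
      A+e∪Z⊆A∪Z : (A ∪ ⁅ e ⁆) ∪ Z ⊆ A ∪ Z
      A+e∪Z⊆A∪Z = ∪-least (∪-least (p⊆p∪q Z)
                    (λ y∈⁅e⁆ → q⊆p∪q A Z (subst (_∈ Z) (sym (x∈⁅y⁆⇒x≡y e y∈⁅e⁆)) e∈Z)))
                    (q⊆p∪q A Z)

  basis-∣∣≡rank : ∀ {ρ B} → IsRankOf M ρ → IsBasis M B → ∣ B ∣ ≡ ρ
  basis-∣∣≡rank {ρ} {B} ((Y , iY , ∣Y∣≡ρ) , rank-bound) (iB , B-maximal)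
    with indep-augment iB iY
  ... | A , iA , B⊆A , _ , ∣Y∣≤∣A∣ =
    ≤-antisym (rank-bound B iB)
              (subst (ρ ≤_) (cong ∣_∣ (B-maximal A iA B⊆A)) (subst (_≤ ∣ A ∣) ∣Y∣≡ρ ∣Y∣≤∣A∣))

  indep∧∣∣≡rank⇒basis : ∀ {ρ B} → IsRankOf M ρ → Indep M B → ∣ B ∣ ≡ ρ → IsBasis M B
  indep∧∣∣≡rank⇒basis (_ , rank-bound) iB ∣B∣≡ρ = iB , λ X iX B⊆X →
    sym (p⊆q∧∣q∣≤∣p∣⇒p≡q B⊆X (subst (∣ X ∣ ≤_) (sym ∣B∣≡ρ) (rank-bound X iX)))

  -- Spans T X encodes r(T ∪ X) = r(T), i.e. X lies in the closure of T.
  Spans : Subset n → Subset n → Set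
  Spans T X = ∀ {Z} → Indep M Z → Z ⊆ T ∪ X → ∃ λ Z′ → Indep M Z′ × Z′ ⊆ T × ∣ Z ∣ ≤ ∣ Z′ ∣

  spans-⊥ : ∀ {T} → Spans T ⊥
  spans-⊥ {T} {Z} iZ Z⊆T∪⊥ = Z , iZ , subst (Z ⊆_) (∪-identityʳ T) Z⊆T∪⊥ , ≤-reflexive refl

  spans-∪ : ∀ {T X Y} → Spans T X → Spans (T ∪ X) Y → Spans T (X ∪ Y)
  spans-∪ {T} {X} {Y} T-spans-X TX-spans-Y {Z} iZ Z⊆
    with TX-spans-Y iZ (subst (Z ⊆_) (sym (∪-assoc T X Y)) Z⊆)
  ... | Z₁ , iZ₁ , Z₁⊆T∪X , ∣Z∣≤∣Z₁∣ with T-spans-X iZ₁ Z₁⊆T∪X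
  ... | Z′ , iZ′ , Z′⊆T , ∣Z₁∣≤∣Z′∣ = Z′ , iZ′ , Z′⊆T , ≤-trans ∣Z∣≤∣Z₁∣ ∣Z₁∣≤∣Z′∣

  circuit-spans : ∀ {C T d} → IsCircuit M C → d ∈ C → C - d ⊆ T → Spans T ⁅ d ⁆
  circuit-spans {C} {T} {d} (C-dependent , C-minimal) d∈C C-d⊆T {Z} iZ Z⊆T∪d
    with indep-augment (C-minimal (C - d) (x∈p⇒p-x⊂p d∈C)) iZ
  ... | A , iA , C-d⊆A , A⊆C-d∪Z , ∣Z∣≤∣A∣ = A , iA , A⊆T , ∣Z∣≤∣A∣
    where
    d∉A : d ∉ A
    d∉A d∈A = C-dependent (indep-⊆ M iA C⊆A)
      where
      C⊆A : C ⊆ A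
      C⊆A = ∪-least C-d⊆A (λ y∈⁅d⁆ → subst (_∈ A) (sym (x∈⁅y⁆⇒x≡y d y∈⁅d⁆)) d∈A)
          ∘ p⊆p-x∪⁅x⁆ C d

    Z⊆T : Z ⊆ T ∪ ⁅ d ⁆ → ∀ {y} → y ∈ A → y ∈ Z → y ∈ T
    Z⊆T Z⊆ y∈A y∈Z with x∈p∪q⁻ T ⁅ d ⁆ (Z⊆ y∈Z)
    ... | inj₁ y∈T   = y∈T
    ... | inj₂ y∈⁅d⁆ = contradiction (subst (_∈ A) (x∈⁅y⁆⇒x≡y d y∈⁅d⁆) y∈A) d∉A

    A⊆T : A ⊆ T
    A⊆T y∈A = [ C-d⊆T , Z⊆T Z⊆T∪d y∈A ] (x∈p∪q⁻ (C - d) Z (A⊆C-d∪Z y∈A))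

  spans-complement⇒indep : ∀ {ρ X} → IsRankOf M ρ → Spans (∁ X) X → ∣ ∁ X ∣ ≤ ρ → Indep M (∁ X)
  spans-complement⇒indep {X = X} ((Y , iY , ∣Y∣≡ρ) , _) ∁X-spans-X ∣∁X∣≤ρ
    with ∁X-spans-X iY (subst (Y ⊆_) (sym (∪-inverseˡ X)) (⊆-max Y))
  ... | Z , iZ , Z⊆∁X , ∣Y∣≤∣Z∣ =
    subst (Indep M) (p⊆q∧∣q∣≤∣p∣⇒p≡q Z⊆∁X (≤-trans ∣∁X∣≤ρ (subst (_≤ ∣ Z ∣) ∣Y∣≡ρ ∣Y∣≤∣Z∣))) iZ

module _ {k : ℕ} (E : Fin k → Subset n) where

  Covered : Subset k → Fin n → Set
  Covered I x = ∃ λ j → j ∈ I × x ∈ E j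

  inExactlyOne? : ∀ I x → Dec (InExactlyOne E I x)
  inExactlyOne? I x = any? λ j → (j ∈? I) ×-dec (x ∈? E j) ×-dec
                        all? (λ j′ → (j′ ∈? I) →-dec (x ∈? E j′) →-dec (j′ ≟ j))

  complement-hits : ∀ {B} → (∀ I → Nonempty I → ¬ (∀ x → InExactlyOne E I x → x ∈ B)) →
                    ∀ I → Nonempty I → ∃ λ x → x ∈ ∁ B × InExactlyOne E I x
  complement-hits {B} B-avoids I I≢∅
    with ¬∀⟶∃¬ n _ (λ x → inExactlyOne? I x →-dec (x ∈? B)) (B-avoids I I≢∅)
  ... | x , ¬[x∈⋁→x∈B] with inExactlyOne? I x | x ∈? B
  ... | yes x∈⋁ | yes x∈B = contradiction (λ _ → x∈B) ¬[x∈⋁→x∈B]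
  ... | yes x∈⋁ | no  x∉B = x , x∉p⇒x∈∁p x∉B , x∈⋁
  ... | no  x∉⋁ | _       = contradiction (λ x∈⋁ → contradiction x∈⋁ x∉⋁) ¬[x∈⋁→x∈B]

module _ {k : ℕ} (M : Matroid n) (E : Fin k → Subset n)
         (E-circuits : ∀ i → IsUnionOfCircuits M (E i)) {D : Subset n}
         (D-hits : ∀ I → Nonempty I → ∃ λ x → x ∈ D × InExactlyOne E I x) where

  record SpannedRepresentatives (I : Subset k) : Set where
    field
      R         : Subset n
      R⊆D       : R ⊆ D
      ∣I∣≤∣R∣   : ∣ I ∣ ≤ ∣ R ∣
      R-covered : ∀ {x} → x ∈ R → Covered E I x
      R-spanned : ∀ T → (∀ {x} → Covered E I x → x ∉ R → x ∈ T) → Spans M T R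

  no-representatives : ∀ {I} → ¬ Nonempty I → SpannedRepresentatives I
  no-representatives {I} I≡∅ = record
    { R         = ⊥
    ; R⊆D       = λ x∈⊥ → contradiction x∈⊥ ∉⊥
    ; ∣I∣≤∣R∣   = ≤-reflexive (trans (cong ∣_∣ (Empty-unique I≡∅)) (trans (∣⊥∣≡0 k) (sym (∣⊥∣≡0 n))))
    ; R-covered = λ x∈⊥ → contradiction x∈⊥ ∉⊥
    ; R-spanned = λ _ _ → spans-⊥ M
    }

  add-representative : ∀ {I j x} → j ∈ I → x ∈ D → x ∈ E j → (∀ j′ → j′ ∈ I → x ∈ E j′ → j′ ≡ j) →
                       SpannedRepresentatives (I - j) → SpannedRepresentatives I
  add-representative {I} {j} {x} j∈I x∈D x∈Ej only-j rep = record
    { R         = R′ ∪ ⁅ x ⁆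
    ; R⊆D       = ∪-least R′⊆D (λ y∈⁅x⁆ → subst (_∈ D) (sym (x∈⁅y⁆⇒x≡y x y∈⁅x⁆)) x∈D)
    ; ∣I∣≤∣R∣   = ∣I∣≤∣R∣
    ; R-covered = [ widen ∘ R′-covered
                  , (λ y∈⁅x⁆ → j , j∈I , subst (_∈ E j) (sym (x∈⁅y⁆⇒x≡y x y∈⁅x⁆)) x∈Ej)
                  ] ∘ x∈p∪q⁻ R′ ⁅ x ⁆
    ; R-spanned = R-spanned
    }
    where
    open SpannedRepresentatives rep renaming
      (R to R′; R⊆D to R′⊆D; ∣I∣≤∣R∣ to ∣I-j∣≤∣R′∣; R-covered to R′-covered; R-spanned to R′-spanned)

    widen : ∀ {y} → Covered E (I - j) y → Covered E I y
    widen (j′ , j′∈I-j , y∈Ej′) = j′ , p─q⊆p I ⁅ j ⁆ j′∈I-j , y∈Ej′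

    x-uncovered : ¬ Covered E (I - j) x
    x-uncovered (j′ , j′∈I-j , x∈Ej′) with only-j j′ (p─q⊆p I ⁅ j ⁆ j′∈I-j) x∈Ej′
    ... | refl = x∉p-x I j j′∈I-j

    x∉R′ : x ∉ R′
    x∉R′ = x-uncovered ∘ R′-covered

    ∣I∣≤∣R∣ : ∣ I ∣ ≤ ∣ R′ ∪ ⁅ x ⁆ ∣
    ∣I∣≤∣R∣ = begin
      ∣ I ∣             ≤⟨ ∣p∣≤1+∣p-x∣ I j ⟩
      suc ∣ I - j ∣     ≤⟨ s≤s ∣I-j∣≤∣R′∣ ⟩
      suc ∣ R′ ∣        ≤⟨ p⊂q⇒∣p∣<∣q∣ (p⊂p∪⁅x⁆ x∉R′) ⟩
      ∣ R′ ∪ ⁅ x ⁆ ∣    ∎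
      where open ≤-Reasoning

    ∉R′∪⁅x⁆ : ∀ {y} → y ∉ R′ → y ≢ x → y ∉ R′ ∪ ⁅ x ⁆
    ∉R′∪⁅x⁆ y∉R′ y≢x = [ y∉R′ , y≢x ∘ x∈⁅y⁆⇒x≡y x ] ∘ x∈p∪q⁻ R′ ⁅ x ⁆

    R-spanned : ∀ T → (∀ {y} → Covered E I y → y ∉ R′ ∪ ⁅ x ⁆ → y ∈ T) → Spans M T (R′ ∪ ⁅ x ⁆)
    R-spanned T T-large with E-circuits j x x∈Ej
    ... | C , C-circuit , C⊆Ej , x∈C =
      spans-∪ M (R′-spanned T T-large′) (circuit-spans M C-circuit x∈C C-x⊆T∪R′)
      where
      T-large′ : ∀ {y} → Covered E (I - j) y → y ∉ R′ → y ∈ T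
      T-large′ y-covered y∉R′ =
        T-large (widen y-covered) (∉R′∪⁅x⁆ y∉R′ λ { refl → x-uncovered y-covered })

      C-x⊆T∪R′ : C - x ⊆ T ∪ R′
      C-x⊆T∪R′ {y} y∈C-x with y ∈? R′
      ... | yes y∈R′ = q⊆p∪q T R′ y∈R′
      ... | no  y∉R′ = p⊆p∪q R′ (T-large (j , j∈I , C⊆Ej (p─q⊆p C ⁅ x ⁆ y∈C-x))
                                        (∉R′∪⁅x⁆ y∉R′ λ { refl → x∉p-x C x y∈C-x }))

  representatives : ∀ I → SpannedRepresentatives I
  representatives = All.wfRec ⊂-wellFounded 0ℓ SpannedRepresentatives step
    where
    step : ∀ I → WfRec _⊂_ SpannedRepresentatives I → SpannedRepresentatives I
    step I rec with nonempty? I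
    ... | no  I≡∅ = no-representatives I≡∅
    ... | yes I≢∅ with D-hits I I≢∅
    ... | x , x∈D , j , j∈I , x∈Ej , only-j =
      add-representative j∈I x∈D x∈Ej only-j (rec (x∈p⇒p-x⊂p j∈I))

  complement-spans : ∣ D ∣ ≡ k → Spans M (∁ D) D
  complement-spans ∣D∣≡k =
    subst (Spans M (∁ D)) R≡D (R-spanned (∁ D) λ _ x∉R → x∉p⇒x∈∁p (x∉R ∘ subst (_ ∈_) (sym R≡D)))
    where
    open SpannedRepresentatives (representatives ⊤)
    R≡D : R ≡ D
    R≡D = p⊆q∧∣q∣≤∣p∣⇒p≡q R⊆D (subst (_≤ ∣ R ∣) (trans (∣⊤∣≡n k) (sym ∣D∣≡k)) ∣I∣≤∣R∣)

InQ⇒∁-isBasis : ∀ {k ρ} (M : Matroid n) → IsRankOf M ρ → k ≡ n ∸ ρ →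
                (E : Fin k → Subset n) → (∀ i → IsUnionOfCircuits M (E i)) →
                ∀ {D} → InQ E D → IsBasis M (∁ D)
InQ⇒∁-isBasis {n} {k} {ρ} M rank@((Y , _ , ∣Y∣≡ρ) , _) k≡n∸ρ E E-circuits {D} (∣D∣≡k , D-hits) =
  indep∧∣∣≡rank⇒basis M rank ∁D-indep ∣∁D∣≡ρ
  where
  open ≡-Reasoning
  ∣∁D∣≡ρ : ∣ ∁ D ∣ ≡ ρ
  ∣∁D∣≡ρ = begin
    ∣ ∁ D ∣          ≡⟨ ∣∁p∣≡n∸∣p∣ D ⟩
    n ∸ ∣ D ∣        ≡⟨ cong (n ∸_) (trans ∣D∣≡k k≡n∸ρ) ⟩
    n ∸ (n ∸ ρ)      ≡⟨ m∸[m∸n]≡n (subst (_≤ n) ∣Y∣≡ρ (∣p∣≤n Y)) ⟩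
    ρ                ∎

  ∁D-indep : Indep M (∁ D)
  ∁D-indep = spans-complement⇒indep M rank (complement-spans M E E-circuits D-hits ∣D∣≡k)
                                        (≤-reflexive ∣∁D∣≡ρ)

lemma4p3 : ∀ {n : ℕ} (M : Matroid n) (ρ k : ℕ) → IsRankOf M ρ → k ≡ n ∸ ρ →
           (E : Fin k → Subset n) → (∀ i → IsUnionOfCircuits M (E i)) →
           ∀ (B : Subset n) → InB′ M E B ⇔ (∃ λ D → InQ E D × B ≡ ∁ D)
lemma4p3 {n} M ρ k rank k≡n∸ρ E E-circuits B = mk⇔ to from
  where
  to : InB′ M E B → ∃ λ D → InQ E D × B ≡ ∁ D
  to (B-basis , B-avoids) =
    ∁ B , (∣∁B∣≡k , complement-hits E B-avoids) , sym (∁-involutive B)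
    where
    ∣∁B∣≡k : ∣ ∁ B ∣ ≡ k
    ∣∁B∣≡k = trans (∣∁p∣≡n∸∣p∣ B) (trans (cong (n ∸_) (basis-∣∣≡rank M rank B-basis)) (sym k≡n∸ρ))

  from : (∃ λ D → InQ E D × B ≡ ∁ D) → InB′ M E B
  from (D , D∈Q@(_ , D-hits) , refl) =
    InQ⇒∁-isBasis M rank k≡n∸ρ E E-circuits D∈Q , λ I I≢∅ ⋁⊆∁D →
      let x , x∈D , x∈⋁ = D-hits I I≢∅ in x∈∁p⇒x∉p (⋁⊆∁D x x∈⋁) x∈D
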